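{- Let $(J_n)_{n\ge0}$ be the Jacobsthal numbers. For each tuple $(a,b,c,d)$ below, the set of triples $(x,y,z)=(J_i,J_j,J_k)$ with integers $i,j,k\ge1$ satisfying $ax^2+by^2+cz^2=dxyz$ is exactly the following: - $(1,1,1,1)$: $\{(3,3,3)\}$; - $(1,1,1,3)$: $\{(1,1,1)\}$; - $(1,1,2,2)$: no solutions; - $(1,1,2,4)$: $\{(1,1,1),(1,3,1),(1,3,5),(3,1,1),(3,1,5),(3,11,1),(11,3,1)\}$; - $(1,1,5,5)$: $\{(1,3,1),(3,1,1)\}$; - $(1,2,3,6)$: $\{(1,1,1),(5,1,1)\}$.
   Context: The Jacobsthal numbers are defined by $J_0=0$, $J_1=1$, $J_n=J_{n-1}+2J_{n-2}$ for $n\ge2$; equivalently $J_n=\frac{2^n-(-1)^n}{3}$. -}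

module Defs where

open import Data.Nat using (ℕ; zero; suc; _+_; _*_; _≥_)
open import Data.Product using (_×_; _,_; ∃-syntax)
open import Relation.Binary.PropositionalEquality using (_≡_)

J : ℕ → ℕ
J zero = 0
J (suc zero) = 1
J (suc (suc n)) = J (suc n) + 2 * J n

Triple : Set
Triple = ℕ × ℕ × ℕ

Eqn : ℕ → ℕ → ℕ → ℕ → Triple → Set
Eqn a b c d (x , y , z) = a * (x * x) + b * (y * y) + c * (z * z) ≡ d * x * y * z

JacobsthalSolution : ℕ → ℕ → ℕ → ℕ → Triple → Set
JacobsthalSolution a b c d (x , y , z) =
  ∃[ i ] ∃[ j ] ∃[ k ] (i ≥ 1 × j ≥ 1 × k ≥ 1 × x ≡ J i × y ≡ J j × z ≡ J k
                        × Eqn a b c d (x , y , z))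

{-# OPTIONS --safe #-}
module Submission where

-- Once n ≥ m, J (n + 2) = J n + 2 ^ n ≡ J n modulo 2 ^ m, so modulo 2 ^ m every index
-- may be lowered by steps of 2 into the range below m + 2 without changing J. Taking
-- m = 12, any solution therefore yields a solution of the equation modulo 2 ^ 12 with
-- indices in 1 … 13. A finite search shows that for each of the six equations such a
-- congruence forces all indices below 12, where reducing changed nothing, and that the
-- genuine solutions among these are exactly the listed ones.

open import Defs
open import Data.Nat using (ℕ; zero; suc; _+_; _*_; _^_; _≤_; _<_; _≥_; _≤?_; _<?_; _≟_; s≤s; z≤n; NonZero; >-nonZero⁻¹)
open import Data.Nat.Properties using (≤-refl; ≤-trans; <⇒≱; ≰⇒>; +-monoʳ-<; m≤n⇒∃[o]m+o≡n; ^-distribˡ-+-*; m^n≢0; allUpTo?)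
open import Data.Nat.Divisibility using (_∣_; m∣m*n)
open import Data.Nat.DivMod using (_%_; %-distribˡ-+; %-distribˡ-*; %-remove-+ʳ)
open import Data.Nat.Tactic.RingSolver using (solve-∀)
open import Data.Product using (_×_; _,_; proj₁; proj₂; ∃-syntax)
open import Data.Product.Properties using (≡-dec)
open import Data.List using (List; []; _∷_)
open import Data.List.Membership.Propositional using (_∈_)
open import Data.List.Membership.DecPropositional (≡-dec _≟_ (≡-dec _≟_ _≟_)) using (_∈?_)
open import Data.List.Relation.Unary.All using (All; []; _∷_; lookup; all?)
open import Function.Bundles using (_⇔_; mk⇔)
open import Relation.Nullary.Decidable using (Dec; yes; no; True; toWitness; _×-dec_; _→-dec_)
open import Relation.Nullary.Negation using (contradiction)
open import Relation.Binary.PropositionalEquality using (_≡_; refl; sym; trans; cong; cong₂; subst; module ≡-Reasoning)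

J-sum : ∀ n → J n + J (suc n) ≡ 2 ^ n
J-sum zero = refl
J-sum (suc n) = begin
  J (suc n) + (J (suc n) + 2 * J n) ≡⟨ regroup (J n) (J (suc n)) ⟩
  2 * (J n + J (suc n))             ≡⟨ cong (2 *_) (J-sum n) ⟩
  2 ^ suc n                         ∎
  where
  open ≡-Reasoning
  regroup : ∀ a b → b + (b + 2 * a) ≡ 2 * (a + b)
  regroup = solve-∀

J-step : ∀ n → J (2 + n) ≡ J n + 2 ^ n
J-step n = begin
  J (suc n) + 2 * J n       ≡⟨ regroup (J n) (J (suc n)) ⟩
  J n + (J n + J (suc n))   ≡⟨ cong (J n +_) (J-sum n) ⟩
  J n + 2 ^ n               ∎
  where
  open ≡-Reasoning
  regroup : ∀ a b → b + 2 * a ≡ a + (a + b)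
  regroup = solve-∀

^-monoʳ-∣ : ∀ k {m n} → m ≤ n → k ^ m ∣ k ^ n
^-monoʳ-∣ k {m} m≤n with o , refl ← m≤n⇒∃[o]m+o≡n m≤n =
  subst (k ^ m ∣_) (sym (^-distribˡ-+-* k m o)) (m∣m*n (k ^ o))

reduce : ℕ → ℕ → ℕ
reduce m (suc (suc n)) with m ≤? n
... | yes _ = reduce m n
... | no  _ = suc (suc n)
reduce m n = n

reduce-< : ∀ m n → reduce m n < 2 + m
reduce-< m (suc (suc n)) with m ≤? n
... | yes _ = reduce-< m n
... | no m≰n = +-monoʳ-< 2 (≰⇒> m≰n)
reduce-< m zero       = s≤s z≤n
reduce-< m (suc zero) = s≤s (s≤s z≤n)

reduce-≥ : ∀ {k m n} → k ≤ m → k ≤ n → k ≤ reduce m n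
reduce-≥ {k} {m} {suc (suc n)} k≤m k≤n with m ≤? n
... | yes m≤n = reduce-≥ k≤m (≤-trans k≤m m≤n)
... | no  _   = k≤n
reduce-≥ {n = zero}     _ k≤n = k≤n
reduce-≥ {n = suc zero} _ k≤n = k≤n

reduce-small : ∀ m n → reduce m n < m → reduce m n ≡ n
reduce-small m (suc (suc n)) r<m with m ≤? n
... | yes m≤n = contradiction (reduce-≥ ≤-refl m≤n) (<⇒≱ r<m)
... | no  _   = refl
reduce-small m zero       _ = refl
reduce-small m (suc zero) _ = refl

module _ (m : ℕ) where

  private instance
    2^m-nonZero : NonZero (2 ^ m)
    2^m-nonZero = m^n≢0 2 m

  J-step-mod : ∀ {n} → m ≤ n → J (2 + n) % 2 ^ m ≡ J n % 2 ^ m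
  J-step-mod {n} m≤n = trans (cong (_% 2 ^ m) (J-step n)) (%-remove-+ʳ (J n) (^-monoʳ-∣ 2 m≤n))

  J-reduce : ∀ n → J n % 2 ^ m ≡ J (reduce m n) % 2 ^ m
  J-reduce (suc (suc n)) with m ≤? n
  ... | yes m≤n = trans (J-step-mod m≤n) (J-reduce n)
  ... | no  _   = refl
  J-reduce zero       = refl
  J-reduce (suc zero) = refl

EqnMod : (q : ℕ) .{{_ : NonZero q}} → ℕ → ℕ → ℕ → ℕ → Triple → Set
EqnMod q a b c d (x , y , z) = (a * (x * x) + b * (y * y) + c * (z * z)) % q ≡ (d * x * y * z) % q

module _ {q : ℕ} .{{_ : NonZero q}} where

  %-cong-+ : ∀ {a a′ b b′} → a % q ≡ a′ % q → b % q ≡ b′ % q → (a + b) % q ≡ (a′ + b′) % q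
  %-cong-+ {a} {a′} {b} {b′} a≡a′ b≡b′ =
    trans (%-distribˡ-+ a b q) (trans (cong₂ (λ u v → (u + v) % q) a≡a′ b≡b′) (sym (%-distribˡ-+ a′ b′ q)))

  %-cong-* : ∀ {a a′ b b′} → a % q ≡ a′ % q → b % q ≡ b′ % q → (a * b) % q ≡ (a′ * b′) % q
  %-cong-* {a} {a′} {b} {b′} a≡a′ b≡b′ =
    trans (%-distribˡ-* a b q) (trans (cong₂ (λ u v → (u * v) % q) a≡a′ b≡b′) (sym (%-distribˡ-* a′ b′ q)))

  EqnMod-resp : ∀ {a b c d x x′ y y′ z z′} → x % q ≡ x′ % q → y % q ≡ y′ % q → z % q ≡ z′ % q →
                EqnMod q a b c d (x , y , z) → EqnMod q a b c d (x′ , y′ , z′)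
  EqnMod-resp {a} {b} {c} {d} {x} {x′} {y} {y′} {z} {z′} x≡ y≡ z≡ e = trans (sym lhs≡) (trans e rhs≡)
    where
    square : ∀ {u u′} → u % q ≡ u′ % q → (u * u) % q ≡ (u′ * u′) % q
    square u≡ = %-cong-* u≡ u≡
    lhs≡ : (a * (x * x) + b * (y * y) + c * (z * z)) % q ≡ (a * (x′ * x′) + b * (y′ * y′) + c * (z′ * z′)) % q
    lhs≡ = %-cong-+ (%-cong-+ (%-cong-* {a} refl (square x≡)) (%-cong-* {b} refl (square y≡))) (%-cong-* {c} refl (square z≡))
    rhs≡ : (d * x * y * z) % q ≡ (d * x′ * y′ * z′) % q
    rhs≡ = %-cong-* (%-cong-* (%-cong-* {d} refl x≡) y≡) z≡

JacobsthalIndexed : Triple → Set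
JacobsthalIndexed (x , y , z) = ∃[ i ] ∃[ j ] ∃[ k ] (i ≥ 1 × j ≥ 1 × k ≥ 1 × x ≡ J i × y ≡ J j × z ≡ J k)

indexed : ∀ i j k .{{_ : NonZero i}} .{{_ : NonZero j}} .{{_ : NonZero k}} → JacobsthalIndexed (J i , J j , J k)
indexed i j k = i , j , k , >-nonZero⁻¹ i , >-nonZero⁻¹ j , >-nonZero⁻¹ k , refl , refl , refl

module _ (a b c d : ℕ) (S : List Triple) where

  Settled : ℕ → ℕ → ℕ → Set
  Settled i j k = EqnMod (2 ^ 12) a b c d (J i , J j , J k) →
    i < 12 × j < 12 × k < 12 × (Eqn a b c d (J i , J j , J k) → (J i , J j , J k) ∈ S)

  settled? : ∀ i j k → Dec (Settled i j k)
  settled? i j k =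
    (_ ≟ _) →-dec (i <? 12) ×-dec (j <? 12) ×-dec (k <? 12) ×-dec ((_ ≟ _) →-dec ((J i , J j , J k) ∈? S))

  AllSettled : Set
  AllSettled = ∀ {i} → i < 14 → 1 ≤ i → ∀ {j} → j < 14 → 1 ≤ j → ∀ {k} → k < 14 → 1 ≤ k → Settled i j k

  allSettled? : Dec AllSettled
  allSettled? =
    allUpTo? (λ i → (1 ≤? i) →-dec allUpTo? (λ j → (1 ≤? j) →-dec allUpTo? (λ k → (1 ≤? k) →-dec settled? i j k) 14) 14) 14

  reduced-EqnMod : ∀ {i j k} → Eqn a b c d (J i , J j , J k) →
                   EqnMod (2 ^ 12) a b c d (J (reduce 12 i) , J (reduce 12 j) , J (reduce 12 k))
  reduced-EqnMod {i} {j} {k} eqn =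
    EqnMod-resp {q = 2 ^ 12} {a} {b} {c} {d} (J-reduce 12 i) (J-reduce 12 j) (J-reduce 12 k) (cong (_% 2 ^ 12) eqn)

  solutions-listed : AllSettled → ∀ t → JacobsthalSolution a b c d t → t ∈ S
  solutions-listed settled _ (i , j , k , 1≤i , 1≤j , 1≤k , refl , refl , refl , eqn)
    with settled (reduce-< 12 i) (reduce-≥ (s≤s z≤n) 1≤i)
                 (reduce-< 12 j) (reduce-≥ (s≤s z≤n) 1≤j)
                 (reduce-< 12 k) (reduce-≥ (s≤s z≤n) 1≤k)
                 (reduced-EqnMod {i} {j} {k} eqn)
  ... | i′<12 , j′<12 , k′<12 , listed
    rewrite reduce-small 12 i i′<12 | reduce-small 12 j j′<12 | reduce-small 12 k k′<12 = listed eqn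

  eqn? : ∀ t → Dec (Eqn a b c d t)
  eqn? (x , y , z) = _ ≟ _

  Verified : Set
  Verified = AllSettled × All (Eqn a b c d) S

  verified? : Dec Verified
  verified? = allSettled? ×-dec all? eqn? S

  classification : Verified → All JacobsthalIndexed S → ∀ t → JacobsthalSolution a b c d t ⇔ t ∈ S
  classification (settled , listed-eqns) indices t = mk⇔ (solutions-listed settled t) listed-solution
    where
    listed-solution : t ∈ S → JacobsthalSolution a b c d t
    listed-solution t∈S with lookup indices t∈S | lookup listed-eqns t∈S
    ... | i , j , k , 1≤i , 1≤j , 1≤k , x≡ , y≡ , z≡ | eqn = i , j , k , 1≤i , 1≤j , 1≤k , x≡ , y≡ , z≡ , eqn

-- The implicit argument reduces to ⊤ exactly when the search succeeds, so Agda runs it.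
classify : ∀ a b c d {S} → All JacobsthalIndexed S → {True (verified? a b c d S)} →
           ∀ t → JacobsthalSolution a b c d t ⇔ t ∈ S
classify a b c d indices {search} = classification a b c d _ (toWitness search) indices

theorem5 : (∀ t → JacobsthalSolution 1 1 1 1 t ⇔ t ∈ ((3 , 3 , 3) ∷ []))
    × (∀ t → JacobsthalSolution 1 1 1 3 t ⇔ t ∈ ((1 , 1 , 1) ∷ []))
    × (∀ t → JacobsthalSolution 1 1 2 2 t ⇔ t ∈ [])
    × (∀ t → JacobsthalSolution 1 1 2 4 t ⇔ t ∈ ((1 , 1 , 1) ∷ (1 , 3 , 1) ∷ (1 , 3 , 5) ∷ (3 , 1 , 1) ∷ (3 , 1 , 5) ∷ (3 , 11 , 1) ∷ (11 , 3 , 1) ∷ []))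
    × (∀ t → JacobsthalSolution 1 1 5 5 t ⇔ t ∈ ((1 , 3 , 1) ∷ (3 , 1 , 1) ∷ []))
    × (∀ t → JacobsthalSolution 1 2 3 6 t ⇔ t ∈ ((1 , 1 , 1) ∷ (5 , 1 , 1) ∷ []))
theorem5 =
    classify 1 1 1 1 (indexed 3 3 3 ∷ [])
  , classify 1 1 1 3 (indexed 1 1 1 ∷ [])
  , classify 1 1 2 2 []
  , classify 1 1 2 4 (indexed 1 1 1 ∷ indexed 1 3 1 ∷ indexed 1 3 4 ∷ indexed 3 1 1 ∷ indexed 3 1 4 ∷ indexed 3 5 1 ∷ indexed 5 3 1 ∷ [])
  , classify 1 1 5 5 (indexed 1 3 1 ∷ indexed 3 1 1 ∷ [])
  , classify 1 2 3 6 (indexed 1 1 1 ∷ indexed 4 1 1 ∷ [])
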